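{- Let $\mathcal{K}$ be any field extension of $\mathbb{F}_q(t,\theta)$. Then the subset $\Theta=\{(d,\overline{d}):d\in A\}$ of $\mathbb{A}^2(\mathcal{K})$ is Zariski dense.
   Context: $q$ is a prime power, $\theta,t$ are independent indeterminates over $\mathbb{F}_q$, $A=\mathbb{F}_q[\theta]$, and for $d=d(\theta)\in A$, $\overline{d}=d(t)\in\mathbb{F}_q[t]$. -}

module Defs where

open import Level using (Level; _⊔_)
open import Data.Nat using (ℕ)
open import Data.Fin using (Fin)
open import Data.List using (List; []; _∷_; map)
open import Data.List.Relation.Unary.All using (All)
open import Data.Product using (Σ; ∃; _×_)
open import Relation.Binary.PropositionalEquality using (_≡_)
open import Relation.Nullary using (¬_)
open import Algebra.Bundles using (CommutativeRing)
open import Algebra.Morphism.Structures using (IsRingHomomorphism)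

record Field (c ℓ : Level) : Set (Level.suc (c ⊔ ℓ)) where
  field
    commutativeRing : CommutativeRing c ℓ
  open CommutativeRing commutativeRing public
  field
    0≉1     : ¬ (0# ≈ 1#)
    inverse : ∀ x → ¬ (x ≈ 0#) → Σ Carrier (λ y → x * y ≈ 1#)

record HasCardinality {c ℓ : Level} (F : Field c ℓ) (q : ℕ) : Set (c ⊔ ℓ) where
  open Field F
  field
    enum       : Fin q → Carrier
    enum-inj   : ∀ i j → enum i ≈ enum j → i ≡ j
    enum-surj  : ∀ x → Σ (Fin q) (λ i → enum i ≈ x)

-- Field homomorphism F → K (ring homomorphism; automatically injective).
IsFieldHom : {c ℓ c' ℓ' : Level} (F : Field c ℓ) (K : Field c' ℓ') →
             (Field.Carrier F → Field.Carrier K) → Set (c ⊔ ℓ ⊔ ℓ')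
IsFieldHom F K f =
  IsRingHomomorphism (CommutativeRing.rawRing (Field.commutativeRing F))
                     (CommutativeRing.rawRing (Field.commutativeRing K)) f

module Poly {c ℓ : Level} (K : Field c ℓ) where
  open Field K

  -- Univariate polynomials as coefficient lists, constant term first.
  Poly₁ : Set c
  Poly₁ = List Carrier

  eval : Poly₁ → Carrier → Carrier
  eval []       x = 0#
  eval (a ∷ as) x = a + x * eval as x

  -- Bivariate polynomials P(X,Y) = Σᵢ Xⁱ Pᵢ(Y), list of Pᵢ.
  Poly₂ : Set c
  Poly₂ = List Poly₁

  eval₂ : Poly₂ → Carrier → Carrier → Carrier
  eval₂ []       x y = 0#
  eval₂ (p ∷ ps) x y = eval p y + x * eval₂ ps x y

  IsZero₂ : Poly₂ → Set (c ⊔ ℓ)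
  IsZero₂ P = All (All (_≈ 0#)) P

mapPoly₂ : {a b : Level} {A : Set a} {B : Set b} → (A → B) → List (List A) → List (List B)
mapPoly₂ f = map (map f)

{-# OPTIONS --safe #-}
-- Only the points (θⁿ, tⁿ) of Θ are needed.  Writing P = Σ c_{jk} X^j Y^k, the
-- value P(θⁿ, tⁿ) is the power sum Σ c_{jk} (θ^j t^k)ⁿ, and the bases θ^j t^k are
-- pairwise distinct because θ^j t^k − θ^j' t^k' is a nonzero polynomial relation
-- over 𝔽_q.  A power sum in pairwise distinct bases that vanishes for every n
-- has all coefficients zero (a Vandermonde argument), so every c_{jk} is zero.
module Submission where

open import Defs
open import Level using (Level; _⊔_)
open import Algebra.Morphism.Structures using (module IsRingHomomorphism)
open import Data.Nat using (ℕ; zero; suc; _≤_)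
open import Data.Nat.Primality using (Prime)
import Data.Nat.Properties as ℕ
open import Data.Product using (Σ; _×_; _,_; proj₁; proj₂; map₁)
open import Data.List using (List; []; _∷_; map; _++_)
open import Data.List.Relation.Unary.All as All using (All; []; _∷_)
import Data.List.Relation.Unary.All.Properties as All
open import Data.List.Relation.Unary.AllPairs as AllPairs using (AllPairs; []; _∷_)
import Data.List.Relation.Unary.AllPairs.Properties as AllPairs
import Relation.Binary.PropositionalEquality as ≡
open ≡ using (_≡_; _≢_)
open import Relation.Nullary using (¬_)
open import Function using (_∘_)

module _ {a} {A : Set a} where

  rowTerms : ℕ → ℕ → List A → List ((ℕ × ℕ) × A)
  rowTerms j k []      = []
  rowTerms j k (c ∷ p) = ((j , k) , c) ∷ rowTerms j (suc k) p

  terms : ℕ → List (List A) → List ((ℕ × ℕ) × A)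
  terms j []      = []
  terms j (p ∷ P) = rowTerms j 0 p ++ terms (suc j) P

  rowTerms-exponents : ∀ j k p →
    All (λ e → proj₁ (proj₁ e) ≡ j × k ≤ proj₂ (proj₁ e)) (rowTerms j k p)
  rowTerms-exponents j k []      = []
  rowTerms-exponents j k (c ∷ p) =
    (≡.refl , ℕ.≤-refl) ∷
    All.map (λ (j≡ , k<) → j≡ , ℕ.<⇒≤ k<) (rowTerms-exponents j (suc k) p)

  terms-exponents : ∀ j P → All (λ e → j ≤ proj₁ (proj₁ e)) (terms j P)
  terms-exponents j []      = []
  terms-exponents j (p ∷ P) =
    All.++⁺ (All.map (λ (j≡ , _) → ℕ.≤-reflexive (≡.sym j≡)) (rowTerms-exponents j 0 p))
            (All.map ℕ.<⇒≤ (terms-exponents (suc j) P))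

  DistinctExponents : List ((ℕ × ℕ) × A) → Set a
  DistinctExponents = AllPairs (λ e e' → proj₁ e ≢ proj₁ e')

  rowTerms-distinct : ∀ j k p → DistinctExponents (rowTerms j k p)
  rowTerms-distinct j k []      = []
  rowTerms-distinct j k (c ∷ p) =
    All.map (λ (_ , k<) eq → ℕ.<⇒≢ k< (≡.cong proj₂ eq)) (rowTerms-exponents j (suc k) p) ∷
    rowTerms-distinct j (suc k) p

  terms-distinct : ∀ j P → DistinctExponents (terms j P)
  terms-distinct j []      = []
  terms-distinct j (p ∷ P) =
    AllPairs.++⁺ (rowTerms-distinct j 0 p) (terms-distinct (suc j) P)
      (All.map (λ (j≡ , _) → All.map (λ j< eq → ℕ.<⇒≢ j< (≡.trans (≡.sym j≡) (≡.cong proj₁ eq)))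
                                     (terms-exponents (suc j) P))
               (rowTerms-exponents j 0 p))

  module _ {ℓ} {Q : A → Set ℓ} where

    All-rowTerms⁻ : ∀ j k p → All (Q ∘ proj₂) (rowTerms j k p) → All Q p
    All-rowTerms⁻ j k []      []        = []
    All-rowTerms⁻ j k (c ∷ p) (qc ∷ qp) = qc ∷ All-rowTerms⁻ j (suc k) p qp

    All-terms⁻ : ∀ j P → All (Q ∘ proj₂) (terms j P) → All (All Q) P
    All-terms⁻ j []      []  = []
    All-terms⁻ j (p ∷ P) qs with All.++⁻ (rowTerms j 0 p) qs
    ... | qp , qP = All-rowTerms⁻ j 0 p qp ∷ All-terms⁻ (suc j) P qP

module PowerSums {a ℓ} (K : Field a ℓ) where
  open Field K hiding (zero)
  open import Algebra.Properties.CommutativeSemiring.Exp commutativeSemiring using (_^_)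
  open import Algebra.Properties.Ring ring using (x∙y⁻¹≈ε⇒x≈y; //-rightDividesˡ)
  open import Algebra.Solver.Ring.NaturalCoefficients.Default commutativeSemiring
  open import Relation.Binary.Reasoning.Setoid setoid

  x*y≈0⇒y≈0 : ∀ {x y} → ¬ x ≈ 0# → x * y ≈ 0# → y ≈ 0#
  x*y≈0⇒y≈0 {x} {y} x≉0 xy≈0 with inverse x x≉0
  ... | x⁻¹ , xx⁻¹≈1 = begin
    y             ≈⟨ *-identityˡ y ⟨
    1# * y        ≈⟨ *-congʳ xx⁻¹≈1 ⟨
    x * x⁻¹ * y   ≈⟨ solve 3 (λ x x⁻¹ y → x :* x⁻¹ :* y := x⁻¹ :* (x :* y)) refl x x⁻¹ y ⟩
    x⁻¹ * (x * y) ≈⟨ *-congˡ xy≈0 ⟩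
    x⁻¹ * 0#      ≈⟨ zeroʳ x⁻¹ ⟩
    0#            ∎

  module _ {i} {I : Set i} (base : I → Carrier) where

    powerSum : (I → Carrier) → List I → ℕ → Carrier
    powerSum coeff []      n = 0#
    powerSum coeff (e ∷ E) n = coeff e * base e ^ n + powerSum coeff E n

    DistinctBases : List I → Set (i ⊔ ℓ)
    DistinctBases = AllPairs (λ e e' → ¬ base e ≈ base e')

    powerSum-vanish : ∀ coeff E n → All (λ e → coeff e ≈ 0#) E → powerSum coeff E n ≈ 0#
    powerSum-vanish coeff []      n []          = refl
    powerSum-vanish coeff (e ∷ E) n (c≈0 ∷ E≈0) = begin
      coeff e * base e ^ n + powerSum coeff E n ≈⟨ +-cong (trans (*-congʳ c≈0) (zeroˡ _)) (powerSum-vanish coeff E n E≈0) ⟩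
      0# + 0#                                   ≈⟨ +-identityʳ 0# ⟩
      0#                                        ∎

    weightBy : Carrier → (I → Carrier) → I → Carrier
    weightBy x coeff e = (base e - x) * coeff e

    -- The shift n ↦ n + 1 minus multiplication by x annihilates the base x.
    powerSum-weightBy : ∀ x coeff E n →
      powerSum (weightBy x coeff) E n + x * powerSum coeff E n ≈ powerSum coeff E (suc n)
    powerSum-weightBy x coeff []      n = trans (+-identityˡ _) (zeroʳ x)
    powerSum-weightBy x coeff (e ∷ E) n = begin
      ((b - x) * c * b ^ n + W) + x * (c * b ^ n + S)
        ≈⟨ solve 6 (λ d c bⁿ W x S → (d :* c :* bⁿ :+ W) :+ x :* (c :* bⁿ :+ S)
                                  := (d :+ x) :* c :* bⁿ :+ (W :+ x :* S))
                 refl (b - x) c (b ^ n) W x S ⟩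
      (b - x + x) * c * b ^ n + (W + x * S)
        ≈⟨ +-cong (*-congʳ (*-congʳ (//-rightDividesˡ x b))) (powerSum-weightBy x coeff E n) ⟩
      b * c * b ^ n + powerSum coeff E (suc n)
        ≈⟨ +-congʳ (solve 3 (λ b c bⁿ → b :* c :* bⁿ := c :* (b :* bⁿ)) refl b c (b ^ n)) ⟩
      c * b ^ suc n + powerSum coeff E (suc n) ∎
      where
      b = base e
      c = coeff e
      W = powerSum (weightBy x coeff) E n
      S = powerSum coeff E n

    weightBy-preserves-vanishing : ∀ x coeff E → (∀ n → powerSum coeff E n ≈ 0#) →
      ∀ n → powerSum (weightBy x coeff) E n ≈ 0#
    weightBy-preserves-vanishing x coeff E vanish n = begin
      W n                           ≈⟨ +-identityʳ _ ⟨
      W n + 0#                      ≈⟨ +-congˡ (zeroʳ x) ⟨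
      W n + x * 0#                  ≈⟨ +-congˡ (*-congˡ (vanish n)) ⟨
      W n + x * powerSum coeff E n  ≈⟨ powerSum-weightBy x coeff E n ⟩
      powerSum coeff E (suc n)      ≈⟨ vanish (suc n) ⟩
      0#                            ∎
      where W = powerSum (weightBy x coeff) E

    vanishingPowerSums⇒coefficientsVanish : ∀ coeff E → DistinctBases E →
      (∀ n → powerSum coeff E n ≈ 0#) → All (λ e → coeff e ≈ 0#) E
    vanishingPowerSums⇒coefficientsVanish coeff []      _                 _      = []
    vanishingPowerSums⇒coefficientsVanish coeff (e ∷ E) (e≉E ∷ distinct) vanish = ce≈0 ∷ E≈0
      where
      weighted : I → Carrier
      weighted = weightBy (base e) coeff

      weighted-vanish : ∀ n → powerSum weighted E n ≈ 0#
      weighted-vanish n = begin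
        powerSum weighted E n                                          ≈⟨ +-identityˡ _ ⟨
        0# + powerSum weighted E n                                     ≈⟨ +-congʳ head≈0 ⟨
        weighted e * base e ^ n + powerSum weighted E n                ≈⟨ weightBy-preserves-vanishing (base e) coeff (e ∷ E) vanish n ⟩
        0#                                                             ∎
        where
        head≈0 : weighted e * base e ^ n ≈ 0#
        head≈0 = trans (*-congʳ (trans (*-congʳ (-‿inverseʳ (base e))) (zeroˡ _))) (zeroˡ _)

      E≈0 : All (λ e → coeff e ≈ 0#) E
      E≈0 = All.zipWith
        (λ (e≉b , [b-e]c≈0) → x*y≈0⇒y≈0 (λ b-e≈0 → e≉b (sym (x∙y⁻¹≈ε⇒x≈y _ _ b-e≈0))) [b-e]c≈0)
        (e≉E , vanishingPowerSums⇒coefficientsVanish weighted E distinct weighted-vanish)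

      ce≈0 : coeff e ≈ 0#
      ce≈0 = begin
        coeff e                             ≈⟨ *-identityʳ _ ⟨
        coeff e * 1#                        ≈⟨ +-identityʳ _ ⟨
        coeff e * 1# + 0#                   ≈⟨ +-congˡ (powerSum-vanish coeff E 0 E≈0) ⟨
        powerSum coeff (e ∷ E) 0            ≈⟨ vanish 0 ⟩
        0#                                  ∎

module MonomialSubstitution {a ℓ} (K : Field a ℓ) where
  open Field K hiding (zero)
  open Poly K
  open PowerSums K
  open import Algebra.Properties.CommutativeSemiring.Exp commutativeSemiring
    using (_^_; ^-congʳ; ^-assocʳ; ^-distrib-*)
  open import Algebra.Solver.Ring.NaturalCoefficients.Default commutativeSemiring
  open import Relation.Binary.Reasoning.Setoid setoid

  eval-cong : ∀ p {y y'} → y ≈ y' → eval p y ≈ eval p y'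
  eval-cong []      y≈y' = refl
  eval-cong (c ∷ p) y≈y' = +-congˡ (*-cong y≈y' (eval-cong p y≈y'))

  eval₂-cong : ∀ P {x x' y y'} → x ≈ x' → y ≈ y' → eval₂ P x y ≈ eval₂ P x' y'
  eval₂-cong []      x≈x' y≈y' = refl
  eval₂-cong (p ∷ P) x≈x' y≈y' = +-cong (eval-cong p y≈y') (*-cong x≈x' (eval₂-cong P x≈x' y≈y'))

  monomialValue : Carrier → Carrier → ℕ × ℕ → Carrier
  monomialValue x y (j , k) = x ^ j * y ^ k

  MonomialsDistinct : Carrier → Carrier → Set ℓ
  MonomialsDistinct x y = ∀ u v → u ≢ v → ¬ monomialValue x y u ≈ monomialValue x y v

  evalTerms : List ((ℕ × ℕ) × Carrier) → Carrier → Carrier → Carrier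
  evalTerms []            x y = 0#
  evalTerms ((u , c) ∷ T) x y = c * monomialValue x y u + evalTerms T x y

  evalTerms-++ : ∀ T T' x y → evalTerms (T ++ T') x y ≈ evalTerms T x y + evalTerms T' x y
  evalTerms-++ []            T' x y = sym (+-identityˡ _)
  evalTerms-++ ((u , c) ∷ T) T' x y =
    trans (+-congˡ (evalTerms-++ T T' x y)) (sym (+-assoc _ _ _))

  evalTerms-rowTerms : ∀ j k p x y →
    x ^ j * (y ^ k * eval p y) ≈ evalTerms (rowTerms j k p) x y
  evalTerms-rowTerms j k []      x y = trans (*-congˡ (zeroʳ _)) (zeroʳ _)
  evalTerms-rowTerms j k (c ∷ p) x y = begin
    x ^ j * (y ^ k * (c + y * eval p y))
      ≈⟨ solve 5 (λ xʲ yᵏ c y e → xʲ :* (yᵏ :* (c :+ y :* e))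
                              := c :* (xʲ :* yᵏ) :+ xʲ :* (y :* yᵏ :* e))
               refl (x ^ j) (y ^ k) c y (eval p y) ⟩
    c * monomialValue x y (j , k) + x ^ j * (y ^ suc k * eval p y)
      ≈⟨ +-congˡ (evalTerms-rowTerms j (suc k) p x y) ⟩
    evalTerms (rowTerms j k (c ∷ p)) x y ∎

  evalTerms-terms : ∀ j P x y → x ^ j * eval₂ P x y ≈ evalTerms (terms j P) x y
  evalTerms-terms j []      x y = zeroʳ _
  evalTerms-terms j (p ∷ P) x y = begin
    x ^ j * (eval p y + x * eval₂ P x y)
      ≈⟨ solve 4 (λ xʲ e x f → xʲ :* (e :+ x :* f) := xʲ :* (con 1 :* e) :+ x :* xʲ :* f)
               refl (x ^ j) (eval p y) x (eval₂ P x y) ⟩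
    x ^ j * (y ^ 0 * eval p y) + x ^ suc j * eval₂ P x y
      ≈⟨ +-cong (evalTerms-rowTerms j 0 p x y) (evalTerms-terms (suc j) P x y) ⟩
    evalTerms (rowTerms j 0 p) x y + evalTerms (terms (suc j) P) x y
      ≈⟨ evalTerms-++ (rowTerms j 0 p) (terms (suc j) P) x y ⟨
    evalTerms (terms j (p ∷ P)) x y ∎

  ^-comm : ∀ x m n → (x ^ m) ^ n ≈ (x ^ n) ^ m
  ^-comm x m n = trans (^-assocʳ x m n) (trans (^-congʳ x (ℕ.*-comm m n)) (sym (^-assocʳ x n m)))

  monomialValue-^ : ∀ x y n u → monomialValue (x ^ n) (y ^ n) u ≈ monomialValue x y u ^ n
  monomialValue-^ x y n (j , k) =
    trans (*-cong (^-comm x n j) (^-comm y n k)) (sym (^-distrib-* (x ^ j) (y ^ k) n))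

  evalTerms-powers : ∀ x y T n →
    evalTerms T (x ^ n) (y ^ n) ≈ powerSum (monomialValue x y ∘ proj₁) proj₂ T n
  evalTerms-powers x y []            n = refl
  evalTerms-powers x y ((u , c) ∷ T) n =
    +-cong (*-congˡ (monomialValue-^ x y n u)) (evalTerms-powers x y T n)

  vanishesAtPowers⇒zero : ∀ {x y} → MonomialsDistinct x y → ∀ P →
    (∀ n → eval₂ P (x ^ n) (y ^ n) ≈ 0#) → IsZero₂ P
  vanishesAtPowers⇒zero {x} {y} distinct P vanish =
    All-terms⁻ 0 P
      (vanishingPowerSums⇒coefficientsVanish (monomialValue x y ∘ proj₁) proj₂ (terms 0 P)
        (AllPairs.map (distinct _ _) (terms-distinct 0 P))
        powerSums-vanish)
    where
    powerSums-vanish : ∀ n → powerSum (monomialValue x y ∘ proj₁) proj₂ (terms 0 P) n ≈ 0#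
    powerSums-vanish n = begin
      powerSum (monomialValue x y ∘ proj₁) proj₂ (terms 0 P) n ≈⟨ evalTerms-powers x y (terms 0 P) n ⟨
      evalTerms (terms 0 P) (x ^ n) (y ^ n)                    ≈⟨ evalTerms-terms 0 P (x ^ n) (y ^ n) ⟨
      1# * eval₂ P (x ^ n) (y ^ n)                             ≈⟨ *-identityˡ _ ⟩
      eval₂ P (x ^ n) (y ^ n)                                  ≈⟨ vanish n ⟩
      0#                                                       ∎

module Binomials {a ℓ} (F : Field a ℓ) where
  open Field F hiding (zero)
  open Poly F
  open import Algebra.Properties.Ring ring using (-‿involutive; -0#≈0#)

  monomial₁ : ℕ → Carrier → Poly₁
  monomial₁ zero    c = c ∷ []
  monomial₁ (suc k) c = 0# ∷ monomial₁ k c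

  monomial₂ : ℕ → ℕ → Carrier → Poly₂
  monomial₂ zero    k c = monomial₁ k c ∷ []
  monomial₂ (suc j) k c = [] ∷ monomial₂ j k c

  infixl 6 _⊕₁_ _⊕₂_

  _⊕₁_ : Poly₁ → Poly₁ → Poly₁
  []      ⊕₁ q       = q
  (c ∷ p) ⊕₁ []      = c ∷ p
  (c ∷ p) ⊕₁ (d ∷ q) = c + d ∷ p ⊕₁ q

  _⊕₂_ : Poly₂ → Poly₂ → Poly₂
  []      ⊕₂ Q       = Q
  (p ∷ P) ⊕₂ []      = p ∷ P
  (p ∷ P) ⊕₂ (q ∷ Q) = p ⊕₁ q ∷ P ⊕₂ Q

  ⊕₁-identityʳ : ∀ p → p ⊕₁ [] ≡ p
  ⊕₁-identityʳ []      = ≡.refl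
  ⊕₁-identityʳ (c ∷ p) = ≡.refl

  1≉0 : ¬ 1# ≈ 0#
  1≉0 1≈0 = 0≉1 (sym 1≈0)

  -1≉0 : ¬ - 1# ≈ 0#
  -1≉0 -1≈0 = 1≉0 (trans (sym (-‿involutive 1#)) (trans (-‿cong -1≈0) -0#≈0#))

  monomial₁-nonzero : ∀ k {c} → ¬ c ≈ 0# → ¬ All (_≈ 0#) (monomial₁ k c)
  monomial₁-nonzero zero    c≉0 (c≈0 ∷ []) = c≉0 c≈0
  monomial₁-nonzero (suc k) c≉0 (_ ∷ rest) = monomial₁-nonzero k c≉0 rest

  binomial₁-nonzero : ∀ {k k' c d} → ¬ c ≈ 0# → ¬ d ≈ 0# → k ≢ k' →
    ¬ All (_≈ 0#) (monomial₁ k c ⊕₁ monomial₁ k' d)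
  binomial₁-nonzero {zero}  {zero}   c≉0 d≉0 k≢k' _ = k≢k' ≡.refl
  binomial₁-nonzero {zero}  {suc k'} c≉0 d≉0 k≢k' (c+0≈0 ∷ _) =
    c≉0 (trans (sym (+-identityʳ _)) c+0≈0)
  binomial₁-nonzero {suc k} {zero}   c≉0 d≉0 k≢k' (0+d≈0 ∷ _) =
    d≉0 (trans (sym (+-identityˡ _)) 0+d≈0)
  binomial₁-nonzero {suc k} {suc k'} c≉0 d≉0 k≢k' (_ ∷ rest) =
    binomial₁-nonzero c≉0 d≉0 (k≢k' ∘ ≡.cong suc) rest

  binomial₂-nonzero : ∀ {j k j' k' c d} → ¬ c ≈ 0# → ¬ d ≈ 0# → (j , k) ≢ (j' , k') →
    ¬ IsZero₂ (monomial₂ j k c ⊕₂ monomial₂ j' k' d)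
  binomial₂-nonzero {zero}  {k} {zero}   c≉0 d≉0 u≢v (row≈0 ∷ _) =
    binomial₁-nonzero c≉0 d≉0 (u≢v ∘ ≡.cong (zero ,_)) row≈0
  binomial₂-nonzero {zero}  {k} {suc j'} c≉0 d≉0 u≢v (row≈0 ∷ _) =
    monomial₁-nonzero k c≉0 (≡.subst (All (_≈ 0#)) (⊕₁-identityʳ (monomial₁ k _)) row≈0)
  binomial₂-nonzero {suc j} {k} {zero} {k'} c≉0 d≉0 u≢v (row≈0 ∷ _) =
    monomial₁-nonzero k' d≉0 row≈0
  binomial₂-nonzero {suc j} {k} {suc j'} c≉0 d≉0 u≢v (_ ∷ rest) =
    binomial₂-nonzero c≉0 d≉0 (u≢v ∘ ≡.cong (map₁ suc)) rest

module Specialisation {a ℓ b ℓ'} (Fq : Field a ℓ) (K : Field b ℓ')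
                      (ι : Field.Carrier Fq → Field.Carrier K) (hom : IsFieldHom Fq K ι) where
  private module F = Field Fq
  open Field K hiding (zero)
  open Poly K
  open Binomials Fq
  open MonomialSubstitution K
  open IsRingHomomorphism hom using (+-homo; 0#-homo; 1#-homo; -‿homo)
  open import Algebra.Properties.CommutativeSemiring.Exp commutativeSemiring using (_^_)
  open import Algebra.Properties.Ring ring using (-1*x≈-x)
  open import Algebra.Solver.Ring.NaturalCoefficients.Default commutativeSemiring
  open import Relation.Binary.Reasoning.Setoid setoid

  eval-map-monomial₁ : ∀ k c z → eval (map ι (monomial₁ k c)) z ≈ ι c * z ^ k
  eval-map-monomial₁ zero    c z = trans (trans (+-congˡ (zeroʳ z)) (+-identityʳ _)) (sym (*-identityʳ _))
  eval-map-monomial₁ (suc k) c z = begin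
    ι F.0# + z * eval (map ι (monomial₁ k c)) z ≈⟨ +-cong 0#-homo (*-congˡ (eval-map-monomial₁ k c z)) ⟩
    0# + z * (ι c * z ^ k)                       ≈⟨ +-identityˡ _ ⟩
    z * (ι c * z ^ k)                            ≈⟨ solve 3 (λ z c zᵏ → z :* (c :* zᵏ) := c :* (z :* zᵏ)) refl z (ι c) (z ^ k) ⟩
    ι c * z ^ suc k                              ∎

  eval₂-map-monomial₂ : ∀ j k c x y →
    eval₂ (mapPoly₂ ι (monomial₂ j k c)) x y ≈ ι c * monomialValue x y (j , k)
  eval₂-map-monomial₂ zero    k c x y = begin
    eval (map ι (monomial₁ k c)) y + x * 0# ≈⟨ +-cong (eval-map-monomial₁ k c y) (zeroʳ x) ⟩
    ι c * y ^ k + 0#                        ≈⟨ +-identityʳ _ ⟩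
    ι c * y ^ k                             ≈⟨ *-congˡ (*-identityˡ _) ⟨
    ι c * (1# * y ^ k)                      ∎
  eval₂-map-monomial₂ (suc j) k c x y = begin
    0# + x * eval₂ (mapPoly₂ ι (monomial₂ j k c)) x y ≈⟨ +-identityˡ _ ⟩
    x * eval₂ (mapPoly₂ ι (monomial₂ j k c)) x y      ≈⟨ *-congˡ (eval₂-map-monomial₂ j k c x y) ⟩
    x * (ι c * (x ^ j * y ^ k))
      ≈⟨ solve 4 (λ x c xʲ yᵏ → x :* (c :* (xʲ :* yᵏ)) := c :* (x :* xʲ :* yᵏ)) refl x (ι c) (x ^ j) (y ^ k) ⟩
    ι c * (x ^ suc j * y ^ k)                         ∎

  eval-map-⊕₁ : ∀ p q z → eval (map ι (p ⊕₁ q)) z ≈ eval (map ι p) z + eval (map ι q) z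
  eval-map-⊕₁ []      q       z = sym (+-identityˡ _)
  eval-map-⊕₁ (c ∷ p) []      z = sym (+-identityʳ _)
  eval-map-⊕₁ (c ∷ p) (d ∷ q) z = begin
    ι (c F.+ d) + z * eval (map ι (p ⊕₁ q)) z
      ≈⟨ +-cong (+-homo c d) (*-congˡ (eval-map-⊕₁ p q z)) ⟩
    (ι c + ι d) + z * (eval (map ι p) z + eval (map ι q) z)
      ≈⟨ solve 5 (λ c d z e f → (c :+ d) :+ z :* (e :+ f) := (c :+ z :* e) :+ (d :+ z :* f))
               refl (ι c) (ι d) z (eval (map ι p) z) (eval (map ι q) z) ⟩
    (ι c + z * eval (map ι p) z) + (ι d + z * eval (map ι q) z) ∎

  eval₂-map-⊕₂ : ∀ P Q x y →
    eval₂ (mapPoly₂ ι (P ⊕₂ Q)) x y ≈ eval₂ (mapPoly₂ ι P) x y + eval₂ (mapPoly₂ ι Q) x y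
  eval₂-map-⊕₂ []      Q       x y = sym (+-identityˡ _)
  eval₂-map-⊕₂ (p ∷ P) []      x y = sym (+-identityʳ _)
  eval₂-map-⊕₂ (p ∷ P) (q ∷ Q) x y = begin
    eval (map ι (p ⊕₁ q)) y + x * eval₂ (mapPoly₂ ι (P ⊕₂ Q)) x y
      ≈⟨ +-cong (eval-map-⊕₁ p q y) (*-congˡ (eval₂-map-⊕₂ P Q x y)) ⟩
    (e p + e q) + x * (e₂ P + e₂ Q)
      ≈⟨ solve 5 (λ c d x f g → (c :+ d) :+ x :* (f :+ g) := (c :+ x :* f) :+ (d :+ x :* g))
               refl (e p) (e q) x (e₂ P) (e₂ Q) ⟩
    (e p + x * e₂ P) + (e q + x * e₂ Q) ∎
    where
    e : Poly.Poly₁ Fq → Carrier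
    e p = eval (map ι p) y
    e₂ : Poly.Poly₂ Fq → Carrier
    e₂ P = eval₂ (mapPoly₂ ι P) x y

  independent⇒monomialsDistinct : ∀ {x y} →
    ((Q : Poly.Poly₂ Fq) → eval₂ (mapPoly₂ ι Q) x y ≈ 0# → Poly.IsZero₂ Fq Q) →
    MonomialsDistinct x y
  independent⇒monomialsDistinct {x} {y} independent u@(j , k) v@(j' , k') u≢v u≈v =
    binomial₂-nonzero 1≉0 -1≉0 u≢v (independent binomial binomial-vanishes)
    where
    binomial : Poly.Poly₂ Fq
    binomial = monomial₂ j k F.1# ⊕₂ monomial₂ j' k' (F.- F.1#)

    xᵘ = monomialValue x y u
    xᵛ = monomialValue x y v

    binomial-vanishes : eval₂ (mapPoly₂ ι binomial) x y ≈ 0#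
    binomial-vanishes = begin
      eval₂ (mapPoly₂ ι binomial) x y
        ≈⟨ eval₂-map-⊕₂ (monomial₂ j k F.1#) (monomial₂ j' k' (F.- F.1#)) x y ⟩
      eval₂ (mapPoly₂ ι (monomial₂ j k F.1#)) x y + eval₂ (mapPoly₂ ι (monomial₂ j' k' (F.- F.1#))) x y
        ≈⟨ +-cong (eval₂-map-monomial₂ j k F.1# x y) (eval₂-map-monomial₂ j' k' (F.- F.1#) x y) ⟩
      ι F.1# * xᵘ + ι (F.- F.1#) * xᵛ
        ≈⟨ +-cong (trans (*-cong 1#-homo u≈v) (*-identityˡ xᵛ)) (*-congʳ (trans (-‿homo F.1#) (-‿cong 1#-homo))) ⟩
      xᵛ + - 1# * xᵛ ≈⟨ +-congˡ (-1*x≈-x xᵛ) ⟩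
      xᵛ - xᵛ        ≈⟨ -‿inverseʳ xᵛ ⟩
      0#             ∎

  vanishesOnΘ⇒vanishesAtPowers : ∀ {x y} P →
    ((d : Poly.Poly₁ Fq) → eval₂ P (eval (map ι d) x) (eval (map ι d) y) ≈ 0#) →
    ∀ n → eval₂ P (x ^ n) (y ^ n) ≈ 0#
  vanishesOnΘ⇒vanishesAtPowers {x} {y} P vanishes n =
    trans (eval₂-cong P (sym (eval-Xⁿ x)) (sym (eval-Xⁿ y))) (vanishes (monomial₁ n F.1#))
    where
    eval-Xⁿ : ∀ z → eval (map ι (monomial₁ n F.1#)) z ≈ z ^ n
    eval-Xⁿ z = trans (eval-map-monomial₁ n F.1# z) (trans (*-congʳ 1#-homo) (*-identityˡ _))

open import Data.Nat using (_^_)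

lemma8 : {c ℓ c' ℓ' : Level} (q : ℕ) (Fq : Field c ℓ) (K : Field c' ℓ') →
         -- q is a prime power and Fq is a field with q elements
         Σ ℕ (λ p → Σ ℕ (λ n → Prime p × q ≡ p ^ suc n)) →
         HasCardinality Fq q →
         -- K is an extension of Fq(t,θ): an embedding ι : Fq → K together
         -- with elements θ, t of K algebraically independent over Fq
         (ι : Field.Carrier Fq → Field.Carrier K) → IsFieldHom Fq K ι →
         (θ t : Field.Carrier K) →
         ((Q : List (List (Field.Carrier Fq))) →
            Field._≈_ K (Poly.eval₂ K (mapPoly₂ ι Q) θ t) (Field.0# K) →
            Poly.IsZero₂ Fq Q) →
         -- Zariski density of Θ = {(d(θ), d(t)) : d ∈ Fq[θ]} in 𝔸²(K):
         -- every P ∈ K[X,Y] vanishing on Θ is the zero polynomial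
         (P : List (List (Field.Carrier K))) →
         ((d : List (Field.Carrier Fq)) →
            Field._≈_ K (Poly.eval₂ K P (Poly.eval K (map ι d) θ)
                                        (Poly.eval K (map ι d) t))
                        (Field.0# K)) →
         Poly.IsZero₂ K P
lemma8 _ Fq K _ _ ι hom θ t independent P vanishesOnΘ =
  vanishesAtPowers⇒zero (independent⇒monomialsDistinct independent) P
    (vanishesOnΘ⇒vanishesAtPowers P vanishesOnΘ)
  where
  open MonomialSubstitution K
  open Specialisation Fq K ι hom
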